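{- Let $p$ be an odd prime and $e$ a positive integer. If $p^e+1=2^a3^b$ for some integers $a$ and $b$, then $e=1$. -}

module Defs where

{-# OPTIONS --safe #-}
-- If e = 2m, then x = pᵐ ≥ 3 and x² + 1 is divisible by neither 3
-- nor 4, which leaves only 2ᵃ3ᵇ ≤ 2.  If e = 3m, then x³ + 1 = (x + 1)(x² − x + 1) and the
-- second factor is odd and not divisible by 9, so it divides 3, forcing x ≤ 2.  Otherwise e is
-- odd and prime to 3, and pᵉ + 1 = (p + 1)q where every common divisor of p + 1 and q divides e.
-- As x³ ≡ x (mod 6), a prime 2 or 3 dividing q also divides p + 1, hence e, which is
-- impossible; so q = 1 and pᵉ = p.
module Submission where

open import Defs
open import Data.Nat using (ℕ; _+_; _*_; _^_; NonZero)
open import Data.Nat.Primality using (Prime)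
open import Relation.Binary.PropositionalEquality using (_≡_; _≢_)

open import Data.Nat using (zero; suc; _≤_; _<_; _%_; _/_; z≤n; s≤s; _≟_; >-nonZero⁻¹; nonTrivial⇒n>1)
open import Data.Nat.Properties
open import Data.Nat.DivMod
open import Data.Nat.Divisibility
open import Data.Nat.Coprimality using (Coprime; coprime-divisor)
open import Data.Nat.Primality using (prime?; prime[2]; prime⇒irreducible; prime⇒nonZero; prime⇒nonTrivial)
open import Data.Nat.Tactic.RingSolver using (solve-∀)
open import Data.Fin using (Fin; toℕ)
open import Data.Fin.Properties using (all?; toℕ-fromℕ<)
open import Data.Integer using (ℤ; 0ℤ; 1ℤ)
import Data.Integer as ℤ
import Data.Integer.Properties as ℤ
import Data.Integer.Divisibility.Signed as ℤ
import Data.Integer.Tactic.RingSolver as ℤ-Solver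
open import Data.List using (_∷_; [])
open import Data.Product using (∃; ∃₂; _×_; _,_)
open import Data.Sum using (inj₁; inj₂)
open import Function using (_∘_)
open import Relation.Binary.Definitions using (tri<; tri≈; tri>)
open import Relation.Nullary using (¬_; yes; no; contradiction)
open import Relation.Nullary.Decidable using (True; toWitness; from-yes; ¬?)
open import Relation.Binary.PropositionalEquality using (refl; sym; trans; cong; subst; module ≡-Reasoning)

∣-resp-% : ∀ {d m n o} .{{_ : NonZero n}} → d ∣ n → m % n ≡ o % n → d ∣ m → d ∣ o
∣-resp-% d∣n eq d∣m = ∣n∣m%n⇒∣m d∣n (subst (_ ∣_) eq (%-presˡ-∣ d∣m d∣n))

module _ (d : ℕ) .{{_ : NonZero d}} (f : ℕ → ℕ)
         (shift : ∀ x → ∃ λ c → f (x + d) ≡ f x + c * d) where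

  %-periodic : ∀ x → f x % d ≡ f (x % d) % d
  %-periodic x = trans (cong (λ y → f y % d) (m≡m%n+[m/n]*n x d)) (shifts (x % d) (x / d))
    where
    open ≡-Reasoning
    shifts : ∀ r k → f (r + k * d) % d ≡ f r % d
    shifts r zero = cong (λ y → f y % d) (+-identityʳ r)
    shifts r (suc k) with shift (r + k * d)
    ... | c , f-shift = begin
      f (r + (d + k * d)) % d    ≡⟨ cong (λ y → f y % d) (+-comm-middle r d (k * d)) ⟩
      f (r + k * d + d) % d      ≡⟨ cong (_% d) f-shift ⟩
      (f (r + k * d) + c * d) % d ≡⟨ [m+kn]%n≡m%n (f (r + k * d)) c d ⟩
      f (r + k * d) % d          ≡⟨ shifts r k ⟩
      f r % d                    ∎
      where
      +-comm-middle : ∀ a b c → a + (b + c) ≡ a + c + b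
      +-comm-middle a b c = trans (cong (a +_) (+-comm b c)) (sym (+-assoc a c b))

  %-periodic-mod : ∀ x → f x % d ≡ f (toℕ (x mod d)) % d
  %-periodic-mod x = trans (%-periodic x) (cong (λ y → f y % d) (sym (toℕ-fromℕ< (m%n<n x d))))

  -- The residue check in the implicit argument is discharged by evaluation once d and f are
  -- concrete.
  ∤-by-residues : {_ : True (all? λ (r : Fin d) → ¬? (d ∣? f (toℕ r)))} → ∀ x → ¬ d ∣ f x
  ∤-by-residues {checked} x = toWitness checked (x mod d) ∘ ∣-resp-% ∣-refl (%-periodic-mod x)

  %-by-residues : {_ : True (all? λ (r : Fin d) → f (toℕ r) % d ≟ toℕ r)} → ∀ x → f x % d ≡ x % d
  %-by-residues {checked} x =
    trans (%-periodic-mod x) (trans (toWitness checked (x mod d)) (toℕ-fromℕ< (m%n<n x d)))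

-- The ring solver cannot parse _^_, so the identities below spell powers out as products.
x²+1-shift : ∀ d x → ∃ λ c → (x + d) ^ 2 + 1 ≡ x ^ 2 + 1 + c * d
x²+1-shift d x = x * 2 + d , identity d x
  where
  identity : ∀ d x → (x + d) * ((x + d) * 1) + 1 ≡ x * (x * 1) + 1 + (x * 2 + d) * d
  identity = solve-∀

x²+x+1-shift : ∀ d x → ∃ λ c → (x + d) * (x + d) + (x + d) + 1 ≡ x * x + x + 1 + c * d
x²+x+1-shift d x = x * 2 + d + 1 , identity d x
  where
  identity : ∀ d x → (x + d) * (x + d) + (x + d) + 1 ≡ x * x + x + 1 + (x * 2 + d + 1) * d
  identity = solve-∀

x³-shift : ∀ d x → ∃ λ c → (x + d) ^ 3 ≡ x ^ 3 + c * d
x³-shift d x = x * x * 3 + x * d * 3 + d * d , identity d x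
  where
  identity : ∀ d x → (x + d) * ((x + d) * ((x + d) * 1))
                     ≡ x * (x * (x * 1)) + (x * x * 3 + x * d * 3 + d * d) * d
  identity = solve-∀

3∤x²+1 : ∀ x → ¬ 3 ∣ x ^ 2 + 1
3∤x²+1 = ∤-by-residues 3 (λ x → x ^ 2 + 1) (x²+1-shift 3)

4∤x²+1 : ∀ x → ¬ 4 ∣ x ^ 2 + 1
4∤x²+1 = ∤-by-residues 4 (λ x → x ^ 2 + 1) (x²+1-shift 4)

2∤x²+x+1 : ∀ x → ¬ 2 ∣ x * x + x + 1
2∤x²+x+1 = ∤-by-residues 2 (λ x → x * x + x + 1) (x²+x+1-shift 2)

9∤x²+x+1 : ∀ x → ¬ 9 ∣ x * x + x + 1
9∤x²+x+1 = ∤-by-residues 9 (λ x → x * x + x + 1) (x²+x+1-shift 9)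

x³%6≡x%6 : ∀ x → x ^ 3 % 6 ≡ x % 6
x³%6≡x%6 = %-by-residues 6 (λ x → x ^ 3) (x³-shift 6)

x^[3+n]%6≡x^[1+n]%6 : ∀ x n → x ^ (3 + n) % 6 ≡ x ^ (1 + n) % 6
x^[3+n]%6≡x^[1+n]%6 x n = begin
  x ^ (3 + n) % 6               ≡⟨ cong (_% 6) (^-distribˡ-+-* x 3 n) ⟩
  (x ^ 3 * x ^ n) % 6           ≡⟨ %-distribˡ-* (x ^ 3) (x ^ n) 6 ⟩
  (x ^ 3 % 6 * (x ^ n % 6)) % 6 ≡⟨ cong (λ y → (y * (x ^ n % 6)) % 6) (x³%6≡x%6 x) ⟩
  (x % 6 * (x ^ n % 6)) % 6     ≡⟨ %-distribˡ-* x (x ^ n) 6 ⟨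
  x ^ (1 + n) % 6               ∎
  where open ≡-Reasoning

x^odd%6≡x%6 : ∀ x k → x ^ (1 + k * 2) % 6 ≡ x % 6
x^odd%6≡x%6 x zero    = cong (_% 6) (*-identityʳ x)
x^odd%6≡x%6 x (suc k) = trans (x^[3+n]%6≡x^[1+n]%6 x (k * 2)) (x^odd%6≡x%6 x k)

∣x^odd+1⇒∣x+1 : ∀ {d} x k → d ∣ 6 → d ∣ x ^ (1 + k * 2) + 1 → d ∣ x + 1
∣x^odd+1⇒∣x+1 x k d∣6 = ∣-resp-% d∣6 (begin
  (x ^ (1 + k * 2) + 1) % 6           ≡⟨ %-distribˡ-+ (x ^ (1 + k * 2)) 1 6 ⟩
  (x ^ (1 + k * 2) % 6 + 1 % 6) % 6   ≡⟨ cong (λ y → (y + 1 % 6) % 6) (x^odd%6≡x%6 x k) ⟩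
  (x % 6 + 1 % 6) % 6                 ≡⟨ %-distribˡ-+ x 1 6 ⟨
  (x + 1) % 6                         ∎)
  where open ≡-Reasoning

prime∤⇒coprime : ∀ {p n} → Prime p → ¬ p ∣ n → Coprime n p
prime∤⇒coprime p-prime p∤n (i∣n , i∣p) with prime⇒irreducible p-prime i∣p
... | inj₁ i≡1 = i≡1
... | inj₂ refl = contradiction i∣n p∤n

coprime-divisor-^ : ∀ {q m n} a → Coprime q m → q ∣ m ^ a * n → q ∣ n
coprime-divisor-^ {q}         zero    _ q∣n       = subst (q ∣_) (+-identityʳ _) q∣n
coprime-divisor-^ {q} {m} {n} (suc a) c q∣m*m^a*n =
  coprime-divisor-^ a c (coprime-divisor c (subst (q ∣_) (*-assoc m (m ^ a) n) q∣m*m^a*n))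

prime[3] : Prime 3
prime[3] = from-yes (prime? 3)

∣2^a*3^b⇒∣3^b : ∀ {q} a b → ¬ 2 ∣ q → q ∣ 2 ^ a * 3 ^ b → q ∣ 3 ^ b
∣2^a*3^b⇒∣3^b a b 2∤q = coprime-divisor-^ a (prime∤⇒coprime prime[2] 2∤q)

∣3^b⇒≡1 : ∀ {q} b → ¬ 3 ∣ q → q ∣ 3 ^ b → q ≡ 1
∣3^b⇒≡1 b 3∤q q∣3^b =
  ∣1⇒≡1 (coprime-divisor-^ b (prime∤⇒coprime prime[3] 3∤q) (subst (_ ∣_) (sym (*-identityʳ _)) q∣3^b))

∣3^b⇒∣3 : ∀ {q} b → ¬ 9 ∣ q → q ∣ 3 ^ b → q ∣ 3
∣3^b⇒∣3 {q} b 9∤q q∣3^b with 3 ∣? q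
... | no 3∤q = subst (_∣ 3) (sym (∣3^b⇒≡1 b 3∤q q∣3^b)) (1∣ 3)
∣3^b⇒∣3 zero    9∤q q∣1    | yes _ = ∣-trans q∣1 (1∣ 3)
∣3^b⇒∣3 (suc b) 9∤q r*3∣3^[1+b] | yes (divides r refl) = subst (λ r → r * 3 ∣ 3) (sym r≡1) ∣-refl
  where
  r≡1 : r ≡ 1
  r≡1 = ∣3^b⇒≡1 b (9∤q ∘ *-monoˡ-∣ 3) (*-cancelˡ-∣ 3 (subst (_∣ 3 ^ suc b) (*-comm r 3) r*3∣3^[1+b]))

2^a*3^b≤2 : ∀ a b → ¬ 3 ∣ 2 ^ a * 3 ^ b → ¬ 4 ∣ 2 ^ a * 3 ^ b → 2 ^ a * 3 ^ b ≤ 2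
2^a*3^b≤2 a             (suc b) 3∤ _  = contradiction (∣n⇒∣m*n (2 ^ a) (m∣m*n (3 ^ b))) 3∤
2^a*3^b≤2 zero          zero    _  _  = s≤s z≤n
2^a*3^b≤2 (suc zero)    zero    _  _  = ≤-refl
2^a*3^b≤2 (suc (suc a)) zero    _  4∤ = contradiction (divides (2 ^ a) (identity (2 ^ a))) 4∤
  where
  identity : ∀ n → 2 * (2 * n) * 1 ≡ n * 4
  identity = solve-∀

-- q is the alternating sum x²ᵏ − x²ᵏ⁻¹ + ⋯ + 1, whose 2k + 1 terms are each ≡ 1 (mod x + 1);
-- the recursion q ↦ x²q − x + 1 needs negative numbers, hence ℤ.
odd-power+1-factorisationℤ : ∀ (x : ℤ) k → ∃₂ λ q t →
  x ℤ.^ (1 + k * 2) ℤ.+ 1ℤ ≡ (x ℤ.+ 1ℤ) ℤ.* q × q ≡ ℤ.+ (1 + k * 2) ℤ.+ (x ℤ.+ 1ℤ) ℤ.* t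
odd-power+1-factorisationℤ x zero = 1ℤ , 0ℤ , ℤ-Solver.solve (x ∷ []) , ℤ-Solver.solve (x ∷ [])
odd-power+1-factorisationℤ x (suc k) with odd-power+1-factorisationℤ x k
... | q , t , factor , q≡e+[x+1]t =
  x ℤ.* x ℤ.* q ℤ.- x ℤ.+ 1ℤ , ℤ.+ (1 + k * 2) ℤ.* (x ℤ.- 1ℤ) ℤ.+ x ℤ.* x ℤ.* t ℤ.- 1ℤ ,
  factor-step x (x ℤ.^ (1 + k * 2)) q factor , residue-step x (1 + k * 2) q t q≡e+[x+1]t
  where
  open ≡-Reasoning
  factor-step : ∀ x y q → y ℤ.+ 1ℤ ≡ (x ℤ.+ 1ℤ) ℤ.* q →
                x ℤ.* (x ℤ.* y) ℤ.+ 1ℤ ≡ (x ℤ.+ 1ℤ) ℤ.* (x ℤ.* x ℤ.* q ℤ.- x ℤ.+ 1ℤ)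
  factor-step x y q y+1≡[x+1]q = begin
    x ℤ.* (x ℤ.* y) ℤ.+ 1ℤ
      ≡⟨ ℤ-Solver.solve (x ∷ y ∷ []) ⟩
    x ℤ.* x ℤ.* (y ℤ.+ 1ℤ) ℤ.- x ℤ.* x ℤ.+ 1ℤ
      ≡⟨ cong (λ z → x ℤ.* x ℤ.* z ℤ.- x ℤ.* x ℤ.+ 1ℤ) y+1≡[x+1]q ⟩
    x ℤ.* x ℤ.* ((x ℤ.+ 1ℤ) ℤ.* q) ℤ.- x ℤ.* x ℤ.+ 1ℤ
      ≡⟨ ℤ-Solver.solve (x ∷ q ∷ []) ⟩
    (x ℤ.+ 1ℤ) ℤ.* (x ℤ.* x ℤ.* q ℤ.- x ℤ.+ 1ℤ)
      ∎
  residue-step : ∀ x n q t → q ≡ ℤ.+ n ℤ.+ (x ℤ.+ 1ℤ) ℤ.* t →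
                 x ℤ.* x ℤ.* q ℤ.- x ℤ.+ 1ℤ
                   ≡ ℤ.+ (2 + n) ℤ.+ (x ℤ.+ 1ℤ) ℤ.* (ℤ.+ n ℤ.* (x ℤ.- 1ℤ) ℤ.+ x ℤ.* x ℤ.* t ℤ.- 1ℤ)
  residue-step x n q t q≡n+[x+1]t = begin
    x ℤ.* x ℤ.* q ℤ.- x ℤ.+ 1ℤ
      ≡⟨ cong (λ z → x ℤ.* x ℤ.* z ℤ.- x ℤ.+ 1ℤ) q≡n+[x+1]t ⟩
    x ℤ.* x ℤ.* (ℤ.+ n ℤ.+ (x ℤ.+ 1ℤ) ℤ.* t) ℤ.- x ℤ.+ 1ℤ
      ≡⟨ regroup x (ℤ.+ n) t ⟩
    ℤ.+ 2 ℤ.+ ℤ.+ n ℤ.+ (x ℤ.+ 1ℤ) ℤ.* t′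
      ≡⟨ cong (ℤ._+ (x ℤ.+ 1ℤ) ℤ.* t′) (ℤ.pos-+ 2 n) ⟨
    ℤ.+ (2 + n) ℤ.+ (x ℤ.+ 1ℤ) ℤ.* t′
      ∎
    where
    t′ = ℤ.+ n ℤ.* (x ℤ.- 1ℤ) ℤ.+ x ℤ.* x ℤ.* t ℤ.- 1ℤ
    regroup : ∀ x e t → x ℤ.* x ℤ.* (e ℤ.+ (x ℤ.+ 1ℤ) ℤ.* t) ℤ.- x ℤ.+ 1ℤ
                        ≡ ℤ.+ 2 ℤ.+ e ℤ.+ (x ℤ.+ 1ℤ) ℤ.* (e ℤ.* (x ℤ.- 1ℤ) ℤ.+ x ℤ.* x ℤ.* t ℤ.- 1ℤ)
    regroup = ℤ-Solver.solve-∀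

pos-^ : ∀ m n → ℤ.+ (m ^ n) ≡ (ℤ.+ m) ℤ.^ n
pos-^ m zero    = refl
pos-^ m (suc n) = trans (ℤ.pos-* m (m ^ n)) (cong (ℤ.+ m ℤ.*_) (pos-^ m n))

odd-power+1-factorisation : ∀ x k → ∃ λ q →
  x ^ (1 + k * 2) + 1 ≡ (x + 1) * q × (∀ {d} → d ∣ x + 1 → d ∣ q → d ∣ 1 + k * 2)
odd-power+1-factorisation x k with odd-power+1-factorisationℤ (ℤ.+ x) k
... | q , t , factor , q≡e+[x+1]t = ℤ.∣ q ∣ , factorℕ , common-divisor∣e
  where
  open ≡-Reasoning
  e = 1 + k * 2
  x+1≡ : ℤ.+ (x + 1) ≡ ℤ.+ x ℤ.+ 1ℤ
  x+1≡ = ℤ.pos-+ x 1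
  factorℕ : x ^ e + 1 ≡ (x + 1) * ℤ.∣ q ∣
  factorℕ = begin
    x ^ e + 1                       ≡⟨ cong ℤ.∣_∣ (ℤ.pos-+ (x ^ e) 1) ⟩
    ℤ.∣ ℤ.+ (x ^ e) ℤ.+ 1ℤ ∣          ≡⟨ cong (λ y → ℤ.∣ y ℤ.+ 1ℤ ∣) (pos-^ x e) ⟩
    ℤ.∣ (ℤ.+ x) ℤ.^ e ℤ.+ 1ℤ ∣        ≡⟨ cong ℤ.∣_∣ factor ⟩
    ℤ.∣ (ℤ.+ x ℤ.+ 1ℤ) ℤ.* q ∣        ≡⟨ cong (λ y → ℤ.∣ y ℤ.* q ∣) x+1≡ ⟨
    ℤ.∣ ℤ.+ (x + 1) ℤ.* q ∣          ≡⟨ ℤ.abs-* (ℤ.+ (x + 1)) q ⟩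
    (x + 1) * ℤ.∣ q ∣                ∎
  common-divisor∣e : ∀ {d} → d ∣ x + 1 → d ∣ ℤ.∣ q ∣ → d ∣ e
  common-divisor∣e {d} d∣x+1 d∣q = ℤ.∣⇒∣ᵤ (ℤ.∣m+n∣n⇒∣m {ℤ.+ d} {ℤ.+ e} d∣e+[x+1]t d∣[x+1]t)
    where
    d∣e+[x+1]t : ℤ.+ d ℤ.∣ ℤ.+ e ℤ.+ (ℤ.+ x ℤ.+ 1ℤ) ℤ.* t
    d∣e+[x+1]t = subst (ℤ.+ d ℤ.∣_) q≡e+[x+1]t (ℤ.∣ᵤ⇒∣ d∣q)
    d∣[x+1]t : ℤ.+ d ℤ.∣ (ℤ.+ x ℤ.+ 1ℤ) ℤ.* t
    d∣[x+1]t = ℤ.∣m⇒∣m*n t (subst (ℤ.+ d ℤ.∣_) x+1≡ (ℤ.∣ᵤ⇒∣ d∣x+1))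

2∤1+k*2 : ∀ k → ¬ 2 ∣ 1 + k * 2
2∤1+k*2 k 2∣1+k*2 = contradiction (∣1⇒≡1 (∣m+n∣m⇒∣n 2∣k*2+1 (n∣m*n k))) λ ()
  where
  2∣k*2+1 : 2 ∣ k * 2 + 1
  2∣k*2+1 = subst (2 ∣_) (+-comm 1 (k * 2)) 2∣1+k*2

2∤⇒≡1+k*2 : ∀ n → ¬ 2 ∣ n → ∃ λ k → n ≡ 1 + k * 2
2∤⇒≡1+k*2 zero          2∤0   = contradiction (2 ∣0) 2∤0
2∤⇒≡1+k*2 (suc zero)    _     = 0 , refl
2∤⇒≡1+k*2 (suc (suc n)) 2∤2+n with 2∤⇒≡1+k*2 n (2∤2+n ∘ ∣m∣n⇒∣m+n ∣-refl)
... | k , refl = suc k , refl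

^-injectiveʳ : ∀ {m n o} → 1 < m → m ^ n ≡ m ^ o → n ≡ o
^-injectiveʳ {m} {n} {o} 1<m m^n≡m^o with <-cmp n o
... | tri< n<o _ _ = contradiction m^n≡m^o (<⇒≢ (^-monoʳ-< m 1<m n<o))
... | tri≈ _ n≡o _ = n≡o
... | tri> _ _ n>o = contradiction (sym m^n≡m^o) (<⇒≢ (^-monoʳ-< m 1<m n>o))

x²+1≡2^a*3^b⇒x≤1 : ∀ x a b → x ^ 2 + 1 ≡ 2 ^ a * 3 ^ b → x ≤ 1
x²+1≡2^a*3^b⇒x≤1 x a b eq = ≮⇒≥ λ 1<x → <⇒≱ (^-monoˡ-< 2 1<x) x²≤1
  where
  x²+1≤2 : x ^ 2 + 1 ≤ 2
  x²+1≤2 = subst (_≤ 2) (sym eq)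
    (2^a*3^b≤2 a b (subst (¬_ ∘ (3 ∣_)) eq (3∤x²+1 x)) (subst (¬_ ∘ (4 ∣_)) eq (4∤x²+1 x)))
  x²≤1 : x ^ 2 ≤ 1
  x²≤1 = +-cancelʳ-≤ 1 (x ^ 2) 1 x²+1≤2

x³+1≡2^a*3^b⇒x≤2 : ∀ x a b → x ^ 3 + 1 ≡ 2 ^ a * 3 ^ b → x ≤ 2
x³+1≡2^a*3^b⇒x≤2 zero    a b _  = z≤n
x³+1≡2^a*3^b⇒x≤2 (suc y) a b eq = s≤s (≮⇒≥ λ 1<y → <⇒≱ (3<q 1<y) (∣⇒≤ q∣3))
  where
  q = y * y + y + 1
  cube+1-factorisation : ∀ y → suc y * (suc y * (suc y * 1)) + 1 ≡ (y + 2) * (y * y + y + 1)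
  cube+1-factorisation = solve-∀
  q∣3 : q ∣ 3
  q∣3 = ∣3^b⇒∣3 b (9∤x²+x+1 y)
          (∣2^a*3^b⇒∣3^b a b (2∤x²+x+1 y) (divides (y + 2) (trans (sym eq) (cube+1-factorisation y))))
  3<q : 1 < y → 3 < q
  3<q 1<y = ≤-trans (*-mono-≤ 1<y 1<y) (≤-trans (m≤m+n (y * y) y) (m≤m+n (y * y + y) 1))

x^e+1≡2^a*3^b⇒x^e≡x : ∀ x k a b → ¬ 3 ∣ 1 + k * 2 →
                      x ^ (1 + k * 2) + 1 ≡ 2 ^ a * 3 ^ b → x ^ (1 + k * 2) ≡ x
x^e+1≡2^a*3^b⇒x^e≡x x k a b 3∤e eq with odd-power+1-factorisation x k
... | q , factor , common-divisor∣e = +-cancelʳ-≡ 1 _ _ (begin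
  x ^ (1 + k * 2) + 1 ≡⟨ factor ⟩
  (x + 1) * q         ≡⟨ cong ((x + 1) *_) q≡1 ⟩
  (x + 1) * 1         ≡⟨ *-identityʳ (x + 1) ⟩
  x + 1               ∎)
  where
  open ≡-Reasoning
  ∣x+1 : ∀ {d} → d ∣ 6 → d ∣ q → d ∣ x + 1
  ∣x+1 {d} d∣6 d∣q = ∣x^odd+1⇒∣x+1 x k d∣6 (subst (d ∣_) (sym factor) (∣n⇒∣m*n (x + 1) d∣q))
  2∤q : ¬ 2 ∣ q
  2∤q 2∣q = 2∤1+k*2 k (common-divisor∣e (∣x+1 (divides 3 refl) 2∣q) 2∣q)
  3∤q : ¬ 3 ∣ q
  3∤q 3∣q = 3∤e (common-divisor∣e (∣x+1 (divides 2 refl) 3∣q) 3∣q)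
  q≡1 : q ≡ 1
  q≡1 = ∣3^b⇒≡1 b 3∤q (∣2^a*3^b⇒∣3^b a b 2∤q (divides (x + 1) (trans (sym eq) factor)))

prime≢2⇒3≤p^m : ∀ {p} m .{{_ : NonZero m}} → Prime p → p ≢ 2 → 3 ≤ p ^ m
prime≢2⇒3≤p^m {p} m p-prime p≢2 = ≤-trans 3≤p (subst (_≤ p ^ m) (*-identityʳ p) p^1≤p^m)
  where
  3≤p : 3 ≤ p
  3≤p = ≤∧≢⇒< (nonTrivial⇒n>1 p {{prime⇒nonTrivial p-prime}}) (p≢2 ∘ sym)
  p^1≤p^m : p ^ 1 ≤ p ^ m
  p^1≤p^m = ^-monoʳ-≤ p {{prime⇒nonZero p-prime}} (>-nonZero⁻¹ m)

lemma2p3 : (p e a b : ℕ) → Prime p → p ≢ 2 → NonZero e →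
           p ^ e + 1 ≡ 2 ^ a * 3 ^ b → e ≡ 1
lemma2p3 p e a b p-prime p≢2 e≢0 eq with 2 ∣? e | 3 ∣? e
... | yes (divides m refl) | _ = contradiction
  (≤-trans (x²+1≡2^a*3^b⇒x≤1 (p ^ m) a b (subst (λ n → n + 1 ≡ _) (sym (^-*-assoc p m 2)) eq)) (n≤1+n 1))
  (<⇒≱ (prime≢2⇒3≤p^m m {{m*n≢0⇒m≢0 m {{e≢0}}}} p-prime p≢2))
... | no _ | yes (divides m refl) = contradiction
  (x³+1≡2^a*3^b⇒x≤2 (p ^ m) a b (subst (λ n → n + 1 ≡ _) (sym (^-*-assoc p m 3)) eq))
  (<⇒≱ (prime≢2⇒3≤p^m m {{m*n≢0⇒m≢0 m {{e≢0}}}} p-prime p≢2))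
... | no 2∤e | no 3∤e with 2∤⇒≡1+k*2 e 2∤e
...   | k , refl = ^-injectiveʳ (nonTrivial⇒n>1 p {{prime⇒nonTrivial p-prime}})
                     (trans (x^e+1≡2^a*3^b⇒x^e≡x p k a b 3∤e eq) (sym (*-identityʳ p)))
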